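{- Let $Q$ be finite, $\rho:Q\to\mathbb{N}$ with maximum $m$, $0<k\le m$, and $\mathcal{D}^k$, $(\cdot)^\downarrow$, $(\cdot)^{\uparrow\top}$, $(\cdot)^{\uparrow\bot}$ as in the context. For all types $B,C$: for every $d_2\in\mathcal{D}^k_{B\to C}$ and $e_2\in\mathcal{D}^k_B$, $(d_2(e_2))^\downarrow=d_2^\downarrow(e_2^\downarrow)$; and for every $d_1\in\mathcal{D}^{k-1}_{B\to C}$ and $e_2\in\mathcal{D}^k_B$, $d_1^{\uparrow\bot}(e_2)=(d_1(e_2^\downarrow))^{\uparrow\bot}$ and $d_1^{\uparrow\top}(e_2)=(d_1(e_2^\downarrow))^{\uparrow\top}$.
   Context: $Q_k=\{q:\rho(q)=k\}$, $Q_{\le k}=\{q:\rho(q)\le k\}$. $\mathcal{D}^0_o=\mathcal{P}(Q_0)$, $\mathcal{D}^0_{A\to B}$ = monotone maps $\mathcal{D}^0_A\to\mathcal{D}^0_B$; for $k>0$: $\mathcal{D}^k_o=\mathcal{P}(Q_{\le k})$, $\mathcal{L}^k_o=\{(R,P): R=P\cap Q_{\le k-1}\}$, $\mathcal{L}^k_{A\to B}=\{(f_1,f_2): f_1\in\mathcal{D}^{k-1}_{A\to B}$, $f_2$ monotone $\mathcal{D}^k_A\to\mathcal{D}^k_B$, $(f_1(g_1),f_2(g_2))\in\mathcal{L}^k_B$ whenever $(g_1,g_2)\in\mathcal{L}^k_A\}$, $\mathcal{D}^k_{A\to B}=\{f_2:\exists f_1,(f_1,f_2)\in\mathcal{L}^k_{A\to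 B}\}$; order is inclusion at $o$, pointwise at arrows. $e^\downarrow$ is the unique $d$ with $(d,e)\in\mathcal{L}^k_A$; $d^{\uparrow\top}$, $d^{\uparrow\bot}$ are the greatest and least $e\in\mathcal{D}^k_A$ with $(d,e)\in\mathcal{L}^k_A$. -}

module Defs where

open import Data.Nat using (ℕ; zero; suc; _≤_; _≤?_)
open import Data.Fin using (Fin)
open import Data.Fin.Subset using (Subset; _∈_; _⊆_; _∩_)
open import Data.Vec using (tabulate)
open import Data.Product using (Σ; _×_)
open import Data.Unit using (⊤)
open import Relation.Binary.PropositionalEquality using (_≡_)
open import Relation.Nullary.Decidable using (does)

infixr 5 _⇒_
data Ty : Set where
  o   : Ty
  _⇒_ : Ty → Ty → Ty

module Domains {n : ℕ} (ρ : Fin n → ℕ) where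

  Q≤ : ℕ → Subset n
  Q≤ j = tabulate (λ q → does (ρ q ≤? j))

  -- Ambient carriers: subsets of Q at o, all functions at arrows.
  -- The domains D^k_A are predicates carving out the relevant elements.
  Car : Ty → Set
  Car o       = Subset n
  Car (A ⇒ B) = Car A → Car B

  mutual
    D : ℕ → (A : Ty) → Car A → Set
    D zero    o       P  = ∀ q → q ∈ P → ρ q ≡ 0
    D (suc j) o       P  = ∀ q → q ∈ P → ρ q ≤ suc j
    D zero    (A ⇒ B) f  = Mono zero A B f
    D (suc j) (A ⇒ B) f₂ = Σ (Car (A ⇒ B)) (λ f₁ → L (suc j) (A ⇒ B) f₁ f₂)

    Mono : ℕ → (A B : Ty) → Car (A ⇒ B) → Set
    Mono j A B f =
      (∀ x → D j A x → D j B (f x)) ×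
      (∀ x y → D j A x → D j A y → Le j A x y → Le j B (f x) (f y))

    Le : ℕ → (A : Ty) → Car A → Car A → Set
    Le j o       P Q = P ⊆ Q
    Le j (A ⇒ B) f g = ∀ x → D j A x → Le j B (f x) (g x)

    L : ℕ → (A : Ty) → Car A → Car A → Set
    L zero    A       d e = ⊤  -- ℒ^0 is not defined in the paper; never used
    L (suc j) o       R P = D (suc j) o P × (R ≡ (P ∩ Q≤ j))
    L (suc j) (A ⇒ B) f₁ f₂ =
      D j (A ⇒ B) f₁ ×
      Mono (suc j) A B f₂ ×
      (∀ g₁ g₂ → L (suc j) A g₁ g₂ → L (suc j) B (f₁ g₁) (f₂ g₂))

  Eq : ℕ → (A : Ty) → Car A → Car A → Set
  Eq j o       P Q = P ≡ Q
  Eq j (A ⇒ B) f g = ∀ x → D j A x → Eq j B (f x) (g x)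

  IsDown : ℕ → (A : Ty) → Car A → Car A → Set
  IsDown k A e d = L k A d e

  IsUpBot : ℕ → (A : Ty) → Car A → Car A → Set
  IsUpBot k A d e =
    D k A e × L k A d e × (∀ e′ → D k A e′ → L k A d e′ → Le k A e e′)

  IsUpTop : ℕ → (A : Ty) → Car A → Car A → Set
  IsUpTop k A d e =
    D k A e × L k A d e × (∀ e′ → D k A e′ → L k A d e′ → Le k A e′ e)

-- Restriction and both lifts have explicit descriptions by recursion on types: at o,
-- e↓ = e ∩ Q≤(k−1), d↑⊥ = d and d↑⊤ = d ∪ Q_k; at arrows, f↓ g = (f g↑⊥)↓ and
-- d↑ g = (d g↓)↑.  These pairs lie in ℒᵏ, the relation ℒᵏ determines its left
-- component up to equality, and the constructed lifts are extremal among all partners.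
-- The first claim follows from the defining property of ℒᵏ at arrows and this
-- uniqueness; the other two because extremal lifts are unique and the constructed
-- ones are computed pointwise.
module Submission where

open import Defs
open import Data.Nat using (ℕ; zero; suc; _≤_; _≤?_; _≟_)
open import Data.Nat.Properties using (m≤n⇒m≤1+n; ≤-reflexive; ≤-antisym; ≰⇒>; n≤0⇒n≡0; 1+n≰n)
open import Data.Fin using (Fin)
open import Data.Fin.Subset using (Subset; _∈_; _⊆_; _∩_; _∪_)
open import Data.Fin.Subset.Properties using (⊆-antisym; ⊆-reflexive; x∈p∩q⁺; x∈p∩q⁻; x∈p∪q⁺; x∈p∪q⁻; p∩q⊆p; p∩q⊆q)
open import Data.Vec using (tabulate)
open import Data.Vec.Properties using (lookup⇒[]=; []=⇒lookup; lookup∘tabulate)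
open import Data.Product using (Σ; _×_; _,_; proj₁; proj₂)
open import Data.Sum using (_⊎_; inj₁; inj₂)
open import Relation.Nullary using (yes; no; contradiction)
open import Relation.Nullary.Decidable using (does; dec-true)
open import Level using (0ℓ)
open import Relation.Unary using (Pred; Decidable)
open import Relation.Binary.PropositionalEquality using (_≡_; refl; sym; trans)

∈-tabulate⁺ : ∀ {n} {P : Pred (Fin n) 0ℓ} (P? : Decidable P) {q} →
              P q → q ∈ tabulate (λ x → does (P? x))
∈-tabulate⁺ P? {q} p = lookup⇒[]= q _ (trans (lookup∘tabulate _ q) (dec-true (P? q) p))

∈-tabulate⁻ : ∀ {n} {P : Pred (Fin n) 0ℓ} (P? : Decidable P) {q} →
              q ∈ tabulate (λ x → does (P? x)) → P q
∈-tabulate⁻ P? {q} q∈ with P? q | trans (sym (lookup∘tabulate _ q)) ([]=⇒lookup q∈)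
... | yes p | _  = p
... | no _  | ()

data Extremum : Set where
  least greatest : Extremum

module Properties {n : ℕ} (ρ : Fin n → ℕ) where
  open Domains ρ

  Q≡ : ℕ → Subset n
  Q≡ k = tabulate (λ q → does (ρ q ≟ k))

  D-o⁺ : ∀ l {R} → (∀ q → q ∈ R → ρ q ≤ l) → D l o R
  D-o⁺ zero    bounded q q∈ = n≤0⇒n≡0 (bounded q q∈)
  D-o⁺ (suc l) bounded     = bounded

  D-o⁻ : ∀ l {R} → D l o R → ∀ q → q ∈ R → ρ q ≤ l
  D-o⁻ zero    dR q q∈ = ≤-reflexive (dR q q∈)
  D-o⁻ (suc l) dR      = dR

  Eq⇒Le : ∀ l A {x y} → Eq l A x y → Le l A x y
  Eq⇒Le l o       x≡y = ⊆-reflexive x≡y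
  Eq⇒Le l (A ⇒ B) f≈g = λ x dx → Eq⇒Le l B (f≈g x dx)

  Eq-sym : ∀ l A {x y} → Eq l A x y → Eq l A y x
  Eq-sym l o       x≡y = sym x≡y
  Eq-sym l (A ⇒ B) f≈g = λ x dx → Eq-sym l B (f≈g x dx)

  Le-trans : ∀ l A {x y z} → Le l A x y → Le l A y z → Le l A x z
  Le-trans l o       x⊆y y⊆z = λ q∈ → y⊆z (x⊆y q∈)
  Le-trans l (A ⇒ B) f≤g g≤h = λ x dx → Le-trans l B (f≤g x dx) (g≤h x dx)

  Le-antisym : ∀ l A {x y} → Le l A x y → Le l A y x → Eq l A x y
  Le-antisym l o       x⊆y y⊆x = ⊆-antisym x⊆y y⊆x
  Le-antisym l (A ⇒ B) f≤g g≤f = λ x dx → Le-antisym l B (f≤g x dx) (g≤f x dx)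

  D⇒Mono : ∀ l A B {f} → D l (A ⇒ B) f → Mono l A B f
  D⇒Mono zero    A B mono           = mono
  D⇒Mono (suc l) A B (_ , _ , mono , _) = mono

  Mono-cong : ∀ l A B {f x y} → Mono l A B f → D l A x → D l A y →
              Eq l A x y → Eq l B (f x) (f y)
  Mono-cong l A B (_ , mono) dx dy x≈y =
    Le-antisym l B (mono _ _ dx dy (Eq⇒Le l A x≈y))
                   (mono _ _ dy dx (Eq⇒Le l A (Eq-sym l A x≈y)))

  L⇒Dˡ : ∀ l A {d e} → L (suc l) A d e → D l A d
  L⇒Dˡ l o       {e = P} (_ , refl) =
    D-o⁺ l (λ q q∈ → ∈-tabulate⁻ (λ q → ρ q ≤? l) (proj₂ (x∈p∩q⁻ P _ q∈)))
  L⇒Dˡ l (A ⇒ B) (dd , _) = dd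

  L⇒Dʳ : ∀ l A {d e} → L (suc l) A d e → D (suc l) A e
  L⇒Dʳ l o       (de , _) = de
  L⇒Dʳ l (A ⇒ B) lde      = _ , lde

  mutual
    D-resp-Eq : ∀ l A {x y} → D l A x → Eq l A x y → D l A y
    D-resp-Eq l       o       dx         refl = dx
    D-resp-Eq zero    (A ⇒ B) mono       f≈g  = Mono-resp-Eq zero A B mono f≈g
    D-resp-Eq (suc l) (A ⇒ B) (f₁ , lf)  f≈g  = f₁ , L-respʳ-Eq l (A ⇒ B) lf f≈g

    Mono-resp-Eq : ∀ l A B {f g} → Mono l A B f → Eq l (A ⇒ B) f g → Mono l A B g
    Mono-resp-Eq l A B (preserves , mono) f≈g =
      (λ x dx → D-resp-Eq l B (preserves x dx) (f≈g x dx)) ,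
      (λ x y dx dy x≤y → Le-trans l B (Eq⇒Le l B (Eq-sym l B (f≈g x dx)))
                           (Le-trans l B (mono x y dx dy x≤y) (Eq⇒Le l B (f≈g y dy))))

    L-respʳ-Eq : ∀ l A {d e e′} → L (suc l) A d e → Eq (suc l) A e e′ → L (suc l) A d e′
    L-respʳ-Eq l o       lde                refl = lde
    L-respʳ-Eq l (A ⇒ B) (dd , mono , rel)  f≈g  =
      dd , Mono-resp-Eq (suc l) A B mono f≈g ,
      λ x₁ x₂ lx → L-respʳ-Eq l B (rel x₁ x₂ lx) (f≈g x₂ (L⇒Dʳ l A lx))

  L-respˡ-Eq : ∀ l A {d d′ e} → L (suc l) A d e → Eq l A d d′ → D l A d′ → L (suc l) A d′ e
  L-respˡ-Eq l o       lde               refl _   = lde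
  L-respˡ-Eq l (A ⇒ B) (_ , mono , rel)  f≈g  dg  =
    dg , mono ,
    λ x₁ x₂ lx → L-respˡ-Eq l B (rel x₁ x₂ lx) (f≈g x₁ (L⇒Dˡ l A lx))
                   (proj₁ (D⇒Mono l A B dg) x₁ (L⇒Dˡ l A lx))

  -- Le⟨ greatest ⟩ is the reversed order, so IsUp least and IsUp greatest unfold
  -- to IsUpBot and IsUpTop.
  Le⟨_⟩ : Extremum → ℕ → (A : Ty) → Car A → Car A → Set
  Le⟨ least    ⟩ l A x y = Le l A x y
  Le⟨ greatest ⟩ l A x y = Le l A y x

  IsUp : Extremum → ℕ → (A : Ty) → Car A → Car A → Set
  IsUp s k A d e = D k A e × L k A d e × (∀ e′ → D k A e′ → L k A d e′ → Le⟨ s ⟩ k A e e′)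

  Le⟨⟩-pointwise : ∀ s l A B {f g} → (∀ x → D l A x → Le⟨ s ⟩ l B (f x) (g x)) →
                   Le⟨ s ⟩ l (A ⇒ B) f g
  Le⟨⟩-pointwise least    l A B f≤g = f≤g
  Le⟨⟩-pointwise greatest l A B f≤g = f≤g

  Le⟨⟩-app : ∀ s l A B {f g} → Le⟨ s ⟩ l (A ⇒ B) f g → ∀ x → D l A x → Le⟨ s ⟩ l B (f x) (g x)
  Le⟨⟩-app least    l A B f≤g = f≤g
  Le⟨⟩-app greatest l A B f≤g = f≤g

  Le⟨⟩-trans : ∀ s l A {x y z} → Le⟨ s ⟩ l A x y → Le⟨ s ⟩ l A y z → Le⟨ s ⟩ l A x z
  Le⟨⟩-trans least    l A x≤y y≤z = Le-trans l A x≤y y≤z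
  Le⟨⟩-trans greatest l A y≤x z≤y = Le-trans l A z≤y y≤x

  Le⟨⟩-antisym : ∀ s l A {x y} → Le⟨ s ⟩ l A x y → Le⟨ s ⟩ l A y x → Eq l A x y
  Le⟨⟩-antisym least    l A x≤y y≤x = Le-antisym l A x≤y y≤x
  Le⟨⟩-antisym greatest l A y≤x x≤y = Le-antisym l A x≤y y≤x

  IsUp-unique : ∀ s k A {d e e′} → IsUp s k A d e → IsUp s k A d e′ → Eq k A e e′
  IsUp-unique s k A (de , lde , extremal) (de′ , lde′ , extremal′) =
    Le⟨⟩-antisym s k A (extremal _ de′ lde′) (extremal′ _ de lde)

  module Lifts (j : ℕ) where

    base : Extremum → Subset n → Subset n
    base least    R = R
    base greatest R = R ∪ Q≡ (suc j)

    mutual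
      down : ∀ A → Car A → Car A
      down o       P = P ∩ Q≤ j
      down (A ⇒ B) f = λ g → down B (f (up least A g))

      up : Extremum → ∀ A → Car A → Car A
      up s o       R = base s R
      up s (A ⇒ B) f = λ g → up s B (f (down A g))

    ∈Q≤⁺ : ∀ {q} → ρ q ≤ j → q ∈ Q≤ j
    ∈Q≤⁺ = ∈-tabulate⁺ (λ q → ρ q ≤? j)

    L-base : ∀ s {R} → D j o R → L (suc j) o R (base s R)
    L-base least    dR = (λ q q∈ → m≤n⇒m≤1+n (D-o⁻ j dR q q∈)) ,
      ⊆-antisym (λ q∈ → x∈p∩q⁺ (q∈ , ∈Q≤⁺ (D-o⁻ j dR _ q∈))) (p∩q⊆p _ _)
    L-base greatest {R} dR = (λ q q∈ → level (x∈p∪q⁻ R _ q∈)) ,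
      ⊆-antisym (λ q∈ → x∈p∩q⁺ (x∈p∪q⁺ (inj₁ q∈) , ∈Q≤⁺ (D-o⁻ j dR _ q∈)))
                (λ q∈ → below (x∈p∪q⁻ R _ (p∩q⊆p _ _ q∈))
                               (∈-tabulate⁻ (λ q → ρ q ≤? j) (p∩q⊆q _ _ q∈)))
      where
      level : ∀ {q} → q ∈ R ⊎ q ∈ Q≡ (suc j) → ρ q ≤ suc j
      level (inj₁ q∈R) = m≤n⇒m≤1+n (D-o⁻ j dR _ q∈R)
      level (inj₂ q∈Q) = ≤-reflexive (∈-tabulate⁻ (λ q → ρ q ≟ suc j) q∈Q)
      below : ∀ {q} → q ∈ R ⊎ q ∈ Q≡ (suc j) → ρ q ≤ j → q ∈ R
      below (inj₁ q∈R) _   = q∈R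
      below (inj₂ q∈Q) ρ≤j
        rewrite ∈-tabulate⁻ (λ q → ρ q ≟ suc j) q∈Q = contradiction ρ≤j 1+n≰n

    base-mono : ∀ s {R R′} → R ⊆ R′ → base s R ⊆ base s R′
    base-mono least    R⊆R′ = R⊆R′
    base-mono greatest {R} R⊆R′ q∈ with x∈p∪q⁻ R _ q∈
    ... | inj₁ q∈R = x∈p∪q⁺ (inj₁ (R⊆R′ q∈R))
    ... | inj₂ q∈Q = x∈p∪q⁺ (inj₂ q∈Q)

    base-extremal : ∀ s {R e} → D (suc j) o e → L (suc j) o R e → Le⟨ s ⟩ (suc j) o (base s R) e
    base-extremal least    _  (_ , refl) = p∩q⊆p _ _
    base-extremal greatest de (_ , refl) {q} q∈ with ρ q ≤? j
    ... | yes ρ≤j = x∈p∪q⁺ (inj₁ (x∈p∩q⁺ (q∈ , ∈Q≤⁺ ρ≤j)))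
    ... | no  ρ≰j = x∈p∪q⁺ (inj₂ (∈-tabulate⁺ (λ q → ρ q ≟ suc j) (≤-antisym (de q q∈) (≰⇒> ρ≰j))))

    mutual
      L-down : ∀ A {e} → D (suc j) A e → L (suc j) A (down A e) e
      L-down o       de = de , refl
      L-down (A ⇒ B) {f} (f₁ , df₁ , mono , rel) =
        D-resp-Eq j (A ⇒ B) df₁ f₁≈down , mono ,
        λ g₁ g₂ lg → L-respˡ-Eq j B (rel g₁ g₂ lg) (f₁≈down g₁ (L⇒Dˡ j A lg))
                       (down-D B (proj₁ mono _ (up-D least A (L⇒Dˡ j A lg))))
        where
        f₁≈down : Eq j (A ⇒ B) f₁ (down (A ⇒ B) f)
        f₁≈down g dg = L-unique B (rel g _ (L-up least A dg))
                         (L-down B (proj₁ mono _ (up-D least A dg)))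

      L-up : ∀ s A {d} → D j A d → L (suc j) A d (up s A d)
      L-up s o       dR = L-base s dR
      L-up s (A ⇒ B) {f} df = df , (preserves , monotone) , rel
        where
        mono = D⇒Mono j A B df
        preserves : ∀ g → D (suc j) A g → D (suc j) B (up s B (f (down A g)))
        preserves g dg = up-D s B (proj₁ mono _ (down-D A dg))
        monotone : ∀ g g′ → D (suc j) A g → D (suc j) A g′ → Le (suc j) A g g′ →
                   Le (suc j) B (up s B (f (down A g))) (up s B (f (down A g′)))
        monotone g g′ dg dg′ g≤g′ =
          up-mono s B (proj₁ mono _ (down-D A dg)) (proj₁ mono _ (down-D A dg′))
            (proj₂ mono _ _ (down-D A dg) (down-D A dg′) (down-mono A dg dg′ g≤g′))
        rel : ∀ g₁ g₂ → L (suc j) A g₁ g₂ → L (suc j) B (f g₁) (up s B (f (down A g₂)))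
        rel g₁ g₂ lg = L-respˡ-Eq j B (L-up s B (proj₁ mono _ (down-D A dg₂)))
                         (Mono-cong j A B mono (down-D A dg₂) (L⇒Dˡ j A lg)
                           (L-unique A (L-down A dg₂) lg))
                         (proj₁ mono _ (L⇒Dˡ j A lg))
          where dg₂ = L⇒Dʳ j A lg

      L-unique : ∀ A {d d′ e} → L (suc j) A d e → L (suc j) A d′ e → Eq j A d d′
      L-unique o       (_ , refl)    (_ , refl)     = refl
      L-unique (A ⇒ B) (_ , _ , rel) (_ , _ , rel′) =
        λ g dg → L-unique B (rel g _ (L-up least A dg)) (rel′ g _ (L-up least A dg))

      down-D : ∀ A {e} → D (suc j) A e → D j A (down A e)
      down-D A de = L⇒Dˡ j A (L-down A de)

      up-D : ∀ s A {d} → D j A d → D (suc j) A (up s A d)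
      up-D s A dd = L⇒Dʳ j A (L-up s A dd)

      down-mono : ∀ A {e e′} → D (suc j) A e → D (suc j) A e′ → Le (suc j) A e e′ →
                  Le j A (down A e) (down A e′)
      down-mono o       _  _   e⊆e′ q∈ =
        x∈p∩q⁺ (e⊆e′ (p∩q⊆p _ _ q∈) , p∩q⊆q _ _ q∈)
      down-mono (A ⇒ B) df df′ f≤f′ g dg =
        down-mono B (proj₁ (D⇒Mono (suc j) A B df) _ (up-D least A dg))
                    (proj₁ (D⇒Mono (suc j) A B df′) _ (up-D least A dg))
                    (f≤f′ _ (up-D least A dg))

      up-mono : ∀ s A {d d′} → D j A d → D j A d′ → Le j A d d′ →
                Le (suc j) A (up s A d) (up s A d′)
      up-mono s o       _  _   R⊆R′ = base-mono s R⊆R′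
      up-mono s (A ⇒ B) df df′ f≤f′ g dg =
        up-mono s B (proj₁ (D⇒Mono j A B df) _ (down-D A dg))
                    (proj₁ (D⇒Mono j A B df′) _ (down-D A dg))
                    (f≤f′ _ (down-D A dg))

    up-extremal : ∀ s A {d e} → D (suc j) A e → L (suc j) A d e → Le⟨ s ⟩ (suc j) A (up s A d) e
    up-extremal s o       de                lde           = base-extremal s de lde
    up-extremal s (A ⇒ B) (_ , _ , mono , _) (_ , _ , rel) =
      Le⟨⟩-pointwise s (suc j) A B
        (λ g dg → up-extremal s B (proj₁ mono g dg) (rel _ g (L-down A dg)))

    IsUp-respˡ : ∀ s A {d d′ e} → D j A d → D j A d′ → Eq j A d d′ →
                 IsUp s (suc j) A d e → IsUp s (suc j) A d′ e
    IsUp-respˡ s A dd dd′ d≈d′ (de , lde , extremal) =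
      de , L-respˡ-Eq j A lde d≈d′ dd′ ,
      λ e′ de′ ld′e′ → extremal e′ de′ (L-respˡ-Eq j A ld′e′ (Eq-sym j A d≈d′) dd)

    IsUp-app : ∀ s B C {f u e} → D j (B ⇒ C) f → IsUp s (suc j) (B ⇒ C) f u →
               D (suc j) B e → IsUp s (suc j) C (f (down B e)) (u e)
    IsUp-app s B C df (du , (_ , _ , rel) , extremal) de =
      proj₁ (D⇒Mono (suc j) B C du) _ de , rel _ _ (L-down B de) ,
      λ e′ de′ le′ → Le⟨⟩-trans s (suc j) C
        (Le⟨⟩-app s (suc j) B C (extremal _ (up-D s (B ⇒ C) df) (L-up s (B ⇒ C) df)) _ de)
        (up-extremal s C de′ le′)

    IsUp-apply : ∀ s B C {d₁ e₂ z u w} → D j (B ⇒ C) d₁ → D (suc j) B e₂ →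
                 L (suc j) B z e₂ → IsUp s (suc j) (B ⇒ C) d₁ u →
                 IsUp s (suc j) C (d₁ z) w → Eq (suc j) C (u e₂) w
    IsUp-apply s B C {d₁} dd₁ de₂ lz isUp-u isUp-w =
      IsUp-unique s (suc j) C (IsUp-app s B C dd₁ isUp-u de₂)
        (IsUp-respˡ s C (apply (L⇒Dˡ j B lz)) (apply (down-D B de₂))
          (Mono-cong j B C mono (L⇒Dˡ j B lz) (down-D B de₂) (L-unique B lz (L-down B de₂)))
          isUp-w)
      where
      mono = D⇒Mono j B C dd₁
      apply : ∀ {x} → D j B x → D j C (d₁ x)
      apply = proj₁ mono _

corollary4p3 : {n : ℕ} (ρ : Fin n → ℕ) (m : ℕ) →
    Σ (Fin n) (λ q → ρ q ≡ m) → (∀ q → ρ q ≤ m) →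
    (j : ℕ) → suc j ≤ m → (B C : Ty) →
    let open Domains ρ in
    (∀ d₂ e₂ → D (suc j) (B ⇒ C) d₂ → D (suc j) B e₂ →
       ∀ x y z → IsDown (suc j) C (d₂ e₂) x → IsDown (suc j) (B ⇒ C) d₂ y →
       IsDown (suc j) B e₂ z → Eq j C x (y z))
    ×
    (∀ d₁ e₂ → D j (B ⇒ C) d₁ → D (suc j) B e₂ →
       ∀ z → IsDown (suc j) B e₂ z →
       ∀ u w → IsUpBot (suc j) (B ⇒ C) d₁ u → IsUpBot (suc j) C (d₁ z) w →
       Eq (suc j) C (u e₂) w)
    ×
    (∀ d₁ e₂ → D j (B ⇒ C) d₁ → D (suc j) B e₂ →
       ∀ z → IsDown (suc j) B e₂ z →
       ∀ u w → IsUpTop (suc j) (B ⇒ C) d₁ u → IsUpTop (suc j) C (d₁ z) w →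
       Eq (suc j) C (u e₂) w)
corollary4p3 ρ _ _ _ j _ B C =
  (λ _ e₂ _ _ _ _ z lx (_ , _ , rel) lz → L-unique C lx (rel z e₂ lz)) ,
  (λ _ _ dd₁ de₂ _ lz _ _ → IsUp-apply least    B C dd₁ de₂ lz) ,
  (λ _ _ dd₁ de₂ _ lz _ _ → IsUp-apply greatest B C dd₁ de₂ lz)
  where
  open Properties ρ
  open Lifts j
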